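{- Let $p$ be a prime number and $n > 1$ an integer. Then the set of all solutions $(x,y,z)$ in non-negative integers of the Diophantine equation $$p^x + p^y = z^{2n}$$ is exactly the following: - if $p = 2$: the triples $(2s+1,\, 2s+1,\, 2^{(s+1)/n})$, where $s$ ranges over all non-negative integers with $s+1 \equiv 0 \pmod n$; - if $p \geq 3$: there are no solutions. -}

module Defs where

-- By symmetry let x ≤ y and write y = x + d, so the equation reads
-- p^x · (1 + p^d) = z^(2n).  Splitting z = p^e · w with p ∤ w and comparing
-- p-adic valuations on both sides gives x = 2ne and (1 + p^d) = w^(2n)
-- whenever p ∤ 1 + p^d (lemma power-with-unit-part).
--   * d > 0: then p ∤ 1 + p^d, so 1 + p^d = W² with W = w^n.  Then
--     (W - 1)(W + 1) = p^d, both factors are powers of p differing by 2,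
--     which forces W ∈ {2, 3}; but a proper power w^n (n > 1) is ≤ 1 or ≥ 4.
--   * d = 0: the equation is 2 · p^x = z^(2n).  For p ≠ 2 we get 2 = w^(2n),
--     impossible as before; for p = 2 we get x + 1 = 2ne and w = 1, i.e. the
--     paper's family x = y = 2s + 1, z = 2^k with s + 1 = kn.
module Submission where

open import Defs
open import Data.Nat using (ℕ; _+_; _*_; _^_; _<_)
open import Data.Nat.Primality using (Prime)
open import Data.Product using (Σ; _×_)
open import Function.Bundles using (_⇔_)
open import Relation.Binary.PropositionalEquality using (_≡_)

open import Data.Nat using (zero; suc; _≤_; z≤n; s≤s; NonZero; NonTrivial; _≟_)
open import Data.Nat.Base using (nonTrivial⇒n>1; >-nonZero; ≢-nonZero; ≢-nonZero⁻¹)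
open import Data.Nat.Properties
open import Data.Nat.Divisibility
open import Data.Nat.Induction using (<-rec)
open import Data.Nat.Primality using (euclidsLemma; prime⇒nonZero; prime⇒nonTrivial)
open import Data.Nat.Tactic.RingSolver using (solve-∀)
open import Data.Product using (_,_; ∃; map; map₁; map₂)
open import Data.Sum using (_⊎_; inj₁; inj₂)
import Data.Sum
open import Data.Empty using (⊥; ⊥-elim)
open import Relation.Nullary using (¬_; yes; no; contradiction)
open import Relation.Binary.PropositionalEquality
  using (_≢_; refl; sym; trans; cong; cong₂; subst; module ≡-Reasoning)
open import Function.Bundles using (mk⇔)

open ≡-Reasoning

^-distribʳ-* : ∀ a b m → (a * b) ^ m ≡ a ^ m * b ^ m
^-distribʳ-* a b zero = refl
^-distribʳ-* a b (suc m) = begin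
  a * b * (a * b) ^ m     ≡⟨ cong (a * b *_) (^-distribʳ-* a b m) ⟩
  a * b * (a ^ m * b ^ m) ≡⟨ interchange a b (a ^ m) (b ^ m) ⟩
  a * a ^ m * (b * b ^ m) ∎
  where
  interchange : ∀ a b c d → a * b * (c * d) ≡ a * c * (b * d)
  interchange = solve-∀

^-double : ∀ w n → w ^ (2 * n) ≡ w ^ n * w ^ n
^-double w n = trans (^-distribˡ-+-* w n (n + 0)) (cong (λ t → w ^ n * w ^ t) (+-identityʳ n))

factor-smaller-power : ∀ p x d → p ^ x * (1 + p ^ d) ≡ p ^ x + p ^ (x + d)
factor-smaller-power p x d = trans (*-distribˡ-+ (p ^ x) 1 (p ^ d))
  (cong₂ _+_ (*-identityʳ (p ^ x)) (sym (^-distribˡ-+-* p x d)))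

proper-power-gap : ∀ w n → 1 < n → w ^ n ≤ 1 ⊎ 4 ≤ w ^ n
proper-power-gap zero (suc n) _ = inj₁ z≤n
proper-power-gap (suc zero) n _ = inj₁ (≤-reflexive (^-zeroˡ n))
proper-power-gap (suc (suc _)) (suc zero) (s≤s ())
proper-power-gap w@(suc (suc _)) (suc (suc n)) _ =
  inj₂ (*-mono-≤ 2≤w (*-mono-≤ 2≤w (m^n>0 w n)))
  where
  2≤w : 2 ≤ w
  2≤w = s≤s (s≤s z≤n)

proper-power-∉[2,3] : ∀ {w n m} → 1 < n → w ^ n ≡ m → 2 ≤ m → m ≤ 3 → ⊥
proper-power-∉[2,3] {w} {n} 1<n refl 2≤m m≤3 with proper-power-gap w n 1<n
... | inj₁ m≤1 = <⇒≱ 2≤m m≤1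
... | inj₂ 4≤m = <⇒≱ (s≤s m≤3) 4≤m

-- Two powers of p > 1 that differ by exactly 2 are 1, 3 or 2, 4:
-- the smaller one is 1 or 2.  (If both exponents are ≥ 1 then p ∣ 2,
-- so p = 2; if both are ≥ 2 then p² ∣ 2, which is absurd.)
powers-two-apart : ∀ {p} → 1 < p → ∀ i j → p ^ i + 2 ≡ p ^ j → p ^ i ≡ 1 ⊎ p ^ i ≡ 2
powers-two-apart {p} 1<p zero j _ = inj₁ refl
powers-two-apart {p} 1<p (suc i) zero e =
  contradiction (trans (+-comm 2 (p ^ suc i)) e) λ ()
powers-two-apart {p} 1<p (suc i) (suc zero) e =
  contradiction (*-monoʳ-≤ p (m^n>0 p i))
    (<⇒≱ (≤-trans (m<m+n (p ^ suc i) {2} (s≤s z≤n)) (≤-reflexive e)))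
  where instance _ = >-nonZero (<-trans (s≤s z≤n) 1<p)
powers-two-apart {p} 1<p (suc zero) (suc (suc j)) e =
  inj₂ (trans (*-identityʳ p) (≤-antisym (∣⇒≤ p∣2) 1<p))
  where
  p∣2 : p ∣ 2
  p∣2 = ∣m+n∣m⇒∣n (subst (p ∣_) (sym e) (m∣m*n (p ^ suc j))) (m∣m*n 1)
powers-two-apart {p} 1<p (suc (suc i)) (suc (suc j)) e =
  contradiction (∣⇒≤ p²∣2) (<⇒≱ (≤-trans (n≤1+n 3) (^-monoˡ-≤ 2 1<p)))
  where
  p²∣p^[2+_] : ∀ k → p ^ 2 ∣ p ^ (2 + k)
  p²∣p^[2+ k ] = subst (p ^ 2 ∣_) (sym (^-distribˡ-+-* p 2 k)) (m∣m*n (p ^ k))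
  p²∣2 : p ^ 2 ∣ 2
  p²∣2 = ∣m+n∣m⇒∣n (subst (p ^ 2 ∣_) (sym e) p²∣p^[2+ j ]) p²∣p^[2+ i ]

halve-odd : ∀ x m → suc x ≡ 2 * m → Σ ℕ λ s → s + 1 ≡ m × x ≡ 2 * s + 1
halve-odd x (suc s) 1+x≡2[1+s] = s , +-comm s 1 , suc-injective (trans 1+x≡2[1+s] (double-suc s))
  where
  double-suc : ∀ s → 2 * suc s ≡ suc (2 * s + 1)
  double-suc = solve-∀

TwoPowerSolution : ℕ → ℕ → ℕ → ℕ → Set
TwoPowerSolution n x y z =
  Σ ℕ λ s → Σ ℕ λ k → s + 1 ≡ k * n × x ≡ 2 * s + 1 × y ≡ 2 * s + 1 × z ≡ 2 ^ k

two-power-solution-sym : ∀ {n x y z} → TwoPowerSolution n x y z → TwoPowerSolution n y x z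
two-power-solution-sym (s , k , s+1≡kn , x≡2s+1 , y≡2s+1 , z≡2^k) =
  s , k , s+1≡kn , y≡2s+1 , x≡2s+1 , z≡2^k

family-solves : ∀ n s k → s + 1 ≡ k * n → 2 ^ (2 * s + 1) + 2 ^ (2 * s + 1) ≡ (2 ^ k) ^ (2 * n)
family-solves n s k s+1≡kn = begin
  a + a                   ≡⟨ cong (a +_) (+-identityʳ a) ⟨
  2 ^ (1 + (2 * s + 1))   ≡⟨ cong (2 ^_) (double-successor s) ⟩
  2 ^ (2 * (s + 1))       ≡⟨ cong (λ t → 2 ^ (2 * t)) s+1≡kn ⟩
  2 ^ (2 * (k * n))       ≡⟨ cong (2 ^_) (reassociate k n) ⟩
  2 ^ (k * (2 * n))       ≡⟨ ^-*-assoc 2 k (2 * n) ⟨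
  (2 ^ k) ^ (2 * n)       ∎
  where
  a = 2 ^ (2 * s + 1)
  double-successor : ∀ s → 1 + (2 * s + 1) ≡ 2 * (s + 1)
  double-successor = solve-∀
  reassociate : ∀ k n → 2 * (k * n) ≡ k * (2 * n)
  reassociate = solve-∀

PAdicSplit : ℕ → ℕ → Set
PAdicSplit p z = Σ ℕ λ e → Σ ℕ λ w → z ≡ p ^ e * w × ¬ p ∣ w

p-adic-split : ∀ {p} .{{_ : NonTrivial p}} z → z ≢ 0 → PAdicSplit p z
p-adic-split {p} = <-rec _ split
  where
  split : ∀ z → (∀ {q} → q < z → q ≢ 0 → PAdicSplit p q) → z ≢ 0 → PAdicSplit p z
  split z rec z≢0 with p ∣? z
  ... | no p∤z = 0 , z , sym (*-identityˡ z) , p∤z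
  ... | yes p∣z = extend (rec (quotient-< p∣z) (≢-nonZero⁻¹ q {{quotient≢0 p∣z}}))
    where
    instance _ = ≢-nonZero z≢0
    q = quotient p∣z
    extend : PAdicSplit p q → PAdicSplit p z
    extend (e , w , q≡p^e*w , p∤w) = suc e , w , z≡p^[1+e]*w , p∤w
      where
      z≡p^[1+e]*w : z ≡ p ^ suc e * w
      z≡p^[1+e]*w = begin
        z               ≡⟨ m∣n⇒n≡m*quotient p∣z ⟩
        p * q           ≡⟨ cong (p *_) q≡p^e*w ⟩
        p * (p ^ e * w) ≡⟨ *-assoc p (p ^ e) w ⟨
        p ^ suc e * w   ∎

p-adic-unique : ∀ {p} .{{_ : NonZero p}} a b {u v} → ¬ p ∣ u → ¬ p ∣ v →
                p ^ a * u ≡ p ^ b * v → a ≡ b × u ≡ v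
p-adic-unique zero zero {u} {v} _ _ e = refl , *-cancelˡ-≡ u v 1 e
p-adic-unique {p} zero (suc b) {u} {v} p∤u _ e =
  contradiction (subst (p ∣_) (trans (sym e) (*-identityˡ u)) (∣m⇒∣m*n v (m∣m*n (p ^ b)))) p∤u
p-adic-unique {p} (suc a) zero {u} {v} _ p∤v e =
  contradiction (subst (p ∣_) (trans e (*-identityˡ v)) (∣m⇒∣m*n u (m∣m*n (p ^ a)))) p∤v
p-adic-unique {p} (suc a) (suc b) {u} {v} p∤u p∤v e =
  map₁ (cong suc) (p-adic-unique a b p∤u p∤v (*-cancelˡ-≡ _ _ p
    (trans (sym (*-assoc p (p ^ a) u)) (trans e (*-assoc p (p ^ b) v)))))

module _ {p : ℕ} (p-prime : Prime p) where

  private instance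
    p-nonZero    = prime⇒nonZero p-prime
    p-nonTrivial = prime⇒nonTrivial p-prime

  1<p : 1 < p
  1<p = nonTrivial⇒n>1 p

  p∤1 : ¬ p ∣ 1
  p∤1 p∣1 = <⇒≢ 1<p (sym (∣1⇒≡1 p∣1))

  p∣2⇒p≡2 : p ∣ 2 → p ≡ 2
  p∣2⇒p≡2 p∣2 = ≤-antisym (∣⇒≤ p∣2) 1<p

  p∤-^ : ∀ {w} m → ¬ p ∣ w → ¬ p ∣ w ^ m
  p∤-^ zero _ = p∤1
  p∤-^ {w} (suc m) p∤w p∣w^[1+m] with euclidsLemma w (w ^ m) p-prime p∣w^[1+m]
  ... | inj₁ p∣w   = p∤w p∣w
  ... | inj₂ p∣w^m = p∤-^ m p∤w p∣w^m

  p∤1+p^[1+d] : ∀ d → ¬ p ∣ 1 + p ^ suc d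
  p∤1+p^[1+d] d p∣1+p^[1+d] =
    p∤1 (∣m+n∣m⇒∣n (subst (p ∣_) (+-comm 1 (p ^ suc d)) p∣1+p^[1+d]) (m∣m*n (p ^ d)))

  prime-power-divisor : ∀ d a b → a * b ≡ p ^ d → ∃ λ i → a ≡ p ^ i
  prime-power-divisor zero a b e = 0 , m*n≡1⇒m≡1 a b e
  prime-power-divisor (suc d) a b e with euclidsLemma a b p-prime (subst (p ∣_) (sym e) (m∣m*n (p ^ d)))
  ... | inj₁ (divides q refl) =
    map suc (λ q≡p^i → trans (*-comm q p) (cong (p *_) q≡p^i))
         (prime-power-divisor d q b (*-cancelˡ-≡ _ _ p (trans (rearrange q p b) e)))
    where
    rearrange : ∀ q p b → p * (q * b) ≡ q * p * b
    rearrange = solve-∀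
  ... | inj₂ (divides q refl) =
    prime-power-divisor d a q (*-cancelˡ-≡ _ _ p (trans (rearrange p a q) e))
    where
    rearrange : ∀ p a q → p * (a * q) ≡ a * (q * p)
    rearrange = solve-∀

  -- If 1 + p^d is a square W², then W = 2 or W = 3: writing W = V + 1,
  -- V(V + 2) = p^d, so V and V + 2 are powers of p two apart.
  square-above-prime-power : ∀ d W → 1 + p ^ d ≡ W * W → W ≡ 2 ⊎ W ≡ 3
  square-above-prime-power d (suc V) e = Data.Sum.map (cong suc) (cong suc) V≡1⊎V≡2
    where
    expand : ∀ V → V * (V + 2) ≡ V + V * suc V
    expand = solve-∀
    V[V+2]≡p^d : V * (V + 2) ≡ p ^ d
    V[V+2]≡p^d = trans (expand V) (sym (suc-injective e))
    V≡1⊎V≡2 : V ≡ 1 ⊎ V ≡ 2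
    V≡1⊎V≡2 with prime-power-divisor d V (V + 2) V[V+2]≡p^d
               | prime-power-divisor d (V + 2) V (trans (*-comm (V + 2) V) V[V+2]≡p^d)
    ... | i , V≡p^i | j , V+2≡p^j =
      Data.Sum.map (trans V≡p^i) (trans V≡p^i)
        (powers-two-apart 1<p i j (subst (λ t → t + 2 ≡ p ^ j) V≡p^i V+2≡p^j))

  power-with-unit-part : ∀ x {u} z m → 0 < m → ¬ p ∣ u → p ^ x * u ≡ z ^ m →
                         Σ ℕ λ e → Σ ℕ λ w → z ≡ p ^ e * w × x ≡ e * m × u ≡ w ^ m
  power-with-unit-part x {u} z (suc m) _ p∤u eq with p-adic-split z z≢0
    where
    z≢0 : z ≢ 0
    z≢0 z≡0 = p∤u (subst (p ∣_) (sym u≡0) (p ∣0))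
      where
      instance _ = m^n≢0 p x
      u≡0 : u ≡ 0
      u≡0 = m*n≡0⇒m≡0 u (p ^ x) (trans (*-comm u (p ^ x)) (trans eq (cong (_^ suc m) z≡0)))
  ... | e , w , refl , p∤w =
    e , w , refl , p-adic-unique x (e * suc m) p∤u (p∤-^ (suc m) p∤w) (trans eq power-of-split)
    where
    power-of-split : (p ^ e * w) ^ suc m ≡ p ^ (e * suc m) * w ^ suc m
    power-of-split = trans (^-distribʳ-* (p ^ e) w (suc m))
                           (cong (_* w ^ suc m) (^-*-assoc p e (suc m)))

  module _ {n : ℕ} (1<n : 1 < n) where

    1<2n : 1 < 2 * n
    1<2n = <-≤-trans 1<n (m≤m+n n (n + 0))

    0<2n : 0 < 2 * n
    0<2n = <-trans (s≤s z≤n) 1<2n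

    -- Case y = x + d with d > 0: then 1 + p^d = (w^n)² would force w^n ∈ {2, 3}.
    unequal-exponents : ∀ x d z → p ^ x * (1 + p ^ suc d) ≢ z ^ (2 * n)
    unequal-exponents x d z eq
      with power-with-unit-part x z (2 * n) 0<2n (p∤1+p^[1+d] d) eq
    ... | _ , w , _ , _ , 1+p^[1+d]≡w^2n
      with square-above-prime-power (suc d) (w ^ n) (trans 1+p^[1+d]≡w^2n (^-double w n))
    ... | inj₁ w^n≡2 = proper-power-∉[2,3] 1<n w^n≡2 ≤-refl (s≤s (s≤s z≤n))
    ... | inj₂ w^n≡3 = proper-power-∉[2,3] 1<n w^n≡3 (s≤s (s≤s z≤n)) ≤-refl

    -- Case y = x with p odd: 2·p^x = z^(2n) would make 2 = w^(2n).
    odd-doubled-power : p ≢ 2 → ∀ x z → p ^ x * 2 ≢ z ^ (2 * n)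
    odd-doubled-power p≢2 x z eq
      with power-with-unit-part x z (2 * n) 0<2n (λ p∣2 → p≢2 (p∣2⇒p≡2 p∣2)) eq
    ... | _ , _ , _ , _ , 2≡w^2n = proper-power-∉[2,3] 1<2n (sym 2≡w^2n) ≤-refl (s≤s (s≤s z≤n))

    doubled-power-of-two : p ≡ 2 → ∀ x z → p ^ x * 2 ≡ z ^ (2 * n) → TwoPowerSolution n x x z
    doubled-power-of-two refl x z eq
      with power-with-unit-part (suc x) z (2 * n) 0<2n p∤1
             (trans (*-identityʳ (2 * 2 ^ x)) (trans (*-comm 2 (2 ^ x)) eq))
    ... | k , w , z≡2^k*w , 1+x≡k*2n , 1≡w^2n with m^n≡1⇒n≡0∨m≡1 w (2 * n) (sym 1≡w^2n)
    ...   | inj₁ 2n≡0 = contradiction (sym 2n≡0) (<⇒≢ 0<2n)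
    ...   | inj₂ refl with halve-odd x (k * n) (trans 1+x≡k*2n (reassociate k n))
      where
      reassociate : ∀ k n → k * (2 * n) ≡ 2 * (k * n)
      reassociate = solve-∀
    ...     | s , s+1≡kn , x≡2s+1 =
      s , k , s+1≡kn , x≡2s+1 , x≡2s+1 , trans z≡2^k*w (*-identityʳ (2 ^ k))

    equal-exponents : ∀ x z → p ^ x * 2 ≡ z ^ (2 * n) → p ≡ 2 × TwoPowerSolution n x x z
    equal-exponents x z eq with p ≟ 2
    ... | yes p≡2 = p≡2 , doubled-power-of-two p≡2 x z eq
    ... | no p≢2  = ⊥-elim (odd-doubled-power p≢2 x z eq)

    ordered-solutions : ∀ {x y z} → x ≤ y → p ^ x + p ^ y ≡ z ^ (2 * n) →
                        p ≡ 2 × TwoPowerSolution n x y z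
    ordered-solutions {x} {z = z} x≤y eq with m≤n⇒∃[o]m+o≡n x≤y
    ... | zero , refl =
      map₂ (subst (λ y → TwoPowerSolution n x y z) (sym (+-identityʳ x)))
           (equal-exponents x z (trans (factor-smaller-power p x 0) eq))
    ... | suc d , refl = ⊥-elim (unequal-exponents x d z (trans (factor-smaller-power p x (suc d)) eq))

theorem3p3 : (p n : ℕ) → Prime p → 1 < n → (x y z : ℕ) →
    (p ^ x + p ^ y ≡ z ^ (2 * n)) ⇔
    (p ≡ 2 × Σ ℕ (λ s → Σ ℕ (λ k → s + 1 ≡ k * n × x ≡ 2 * s + 1 × y ≡ 2 * s + 1 × z ≡ 2 ^ k)))
theorem3p3 p n p-prime 1<n x y z = mk⇔ solution⇒family family⇒solution
  where
  solution⇒family : p ^ x + p ^ y ≡ z ^ (2 * n) → p ≡ 2 × TwoPowerSolution n x y z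
  solution⇒family eq with ≤-total x y
  ... | inj₁ x≤y = ordered-solutions p-prime 1<n x≤y eq
  ... | inj₂ y≤x = map₂ two-power-solution-sym
    (ordered-solutions p-prime 1<n y≤x (trans (+-comm (p ^ y) (p ^ x)) eq))

  family⇒solution : p ≡ 2 × TwoPowerSolution n x y z → p ^ x + p ^ y ≡ z ^ (2 * n)
  family⇒solution (refl , s , k , s+1≡kn , refl , refl , refl) = family-solves n s k s+1≡kn
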